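{- Let $G=(V,E)$ be a finite simple undirected graph on $n\ge 2$ nodes and let $\varepsilon>0$. There exists a set of at most $\lfloor \log_{1+\varepsilon}(n)\rfloor+2$ feasible solutions of the LambdaPrime ILP (respectively, of the LambdaPrime LP relaxation) such that for every $\lambda\in(4/n^2,1)$ the set contains a $(1+\varepsilon)$-approximate solution of the ILP (respectively, of the LP relaxation) for parameter $\lambda$.
   Context: Variables $x_{ij}$ are indexed by unordered pairs $i<j$ of nodes. The LambdaPrime ILP with parameter $\lambda$ is: minimize $\sum_{(i,j)\in E}x_{ij}+\sum_{i<j}\lambda(1-x_{ij})$ subject to $x_{ij}\le x_{ik}+x_{jk}$ for all $i,j,k$, and $x_{ij}\in\{0,1\}$. The LambdaPrime LP relaxation is the same program with $0\le x_{ij}\le 1$ instead of $x_{ij}\in\{0,1\}$. A feasible solution is a $(1+\varepsilon)$-approximate solution for $\lambda$ if its objective value at $\lambda$ is at most $(1+\varepsilon)$ times the optimal value of the corresponding program at $\lambda$.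
   Formalization: The parameters ε and λ are rational, and solutions of the LP relaxation have rational entries, including the feasible solutions against which the (1+ε)-approximation is measured. -}

module Defs where

open import Data.Nat as ℕ using (ℕ; zero; suc)
open import Data.Fin using (Fin; toℕ)
open import Data.Bool using (Bool; true; false; if_then_else_)
open import Data.Integer using (+_)
open import Data.Rational using (ℚ; 0ℚ; 1ℚ; _+_; _*_; _-_; _≤_; _<_; _/_)
open import Data.List using (List; foldr; map; allFin)
open import Data.Product using (_×_)
open import Data.Sum using (_⊎_)
open import Relation.Binary.PropositionalEquality using (_≡_; _≢_)

ℕtoℚ : ℕ → ℚ
ℕtoℚ m = + m / 1

_^ℚ_ : ℚ → ℕ → ℚ
q ^ℚ zero  = 1ℚ
q ^ℚ suc k = q * (q ^ℚ k)

IsFloorLog : ℚ → ℕ → ℕ → Set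
IsFloorLog b m k = (b ^ℚ k ≤ ℕtoℚ m) × (ℕtoℚ m < b ^ℚ (suc k))

record Graph (n : ℕ) : Set where
  field
    adj   : Fin n → Fin n → Bool
    sym   : ∀ i j → adj i j ≡ adj j i
    irrefl : ∀ i → adj i i ≡ false

-- A (candidate) solution assigns a rational value x i j to every ordered pair;
-- only the values with toℕ i < toℕ j are used (variables x_{ij}, i < j).
Sol : ℕ → Set
Sol n = Fin n → Fin n → ℚ

val : ∀ {n} → Sol n → Fin n → Fin n → ℚ
val x i j = if toℕ i ℕ.<ᵇ toℕ j then x i j else x j i

sumℚ : List ℚ → ℚ
sumℚ = foldr _+_ 0ℚ

pairSum : ∀ {n} → (Fin n → Fin n → ℚ) → ℚ
pairSum {n} f =
  sumℚ (map (λ i → sumℚ (map (λ j → if toℕ i ℕ.<ᵇ toℕ j then f i j else 0ℚ) (allFin n))) (allFin n))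

objective : ∀ {n} → Graph n → ℚ → Sol n → ℚ
objective G λ' x =
  pairSum (λ i j → if Graph.adj G i j then x i j else 0ℚ)
  + pairSum (λ i j → λ' * (1ℚ - x i j))

Triangle : ∀ {n} → Sol n → Set
Triangle {n} x = ∀ (i j k : Fin n) → i ≢ j → i ≢ k → j ≢ k →
  val x i j ≤ val x i k + val x j k

ILPFeasible : ∀ {n} → Sol n → Set
ILPFeasible {n} x = Triangle x ×
  (∀ (i j : Fin n) → toℕ i ℕ.< toℕ j → (x i j ≡ 0ℚ) ⊎ (x i j ≡ 1ℚ))

LPFeasible : ∀ {n} → Sol n → Set
LPFeasible {n} x = Triangle x ×
  (∀ (i j : Fin n) → toℕ i ℕ.< toℕ j → (0ℚ ≤ x i j) × (x i j ≤ 1ℚ))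

Approx : ∀ {n} → (Sol n → Set) → Graph n → ℚ → ℚ → Sol n → Set
Approx {n} F G ε λ' x = F x ×
  (∀ (y : Sol n) → F y → objective G λ' x ≤ (1ℚ + ε) * objective G λ' y)

-- The objective is A(x) + λ·B(x) with A, B ≥ 0 on the unit cube, so a (1+δ)-approximate solution
-- at μ is a (1+δ)·max(λ/μ, μ/λ)-approximate solution at λ. With u = (1+δ)/(1+ε), solutions for
-- μ = u, u³, …, u^(2K-1) thus serve all of [u^(2K), 1), and for K = ⌊log_{1+ε} n⌋ + 1 and
-- δ = 1/(2K) Bernoulli's inequality gives (1+δ)^K ≤ 2, hence u^(2K) ≤ 4/n².
-- For a single μ, round every entry of a feasible solution up to a grid of mesh w ≤ δμ: rounding up
-- is subadditive, so the triangle inequalities survive, it fixes 0 and 1, and it raises the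
-- objective by at most w·|E| ≤ δ·OPT. The best feasible point of the finite grid is therefore a
-- (1+δ)-approximate solution of the ILP and of the LP alike.

module Submission where

open import Defs
open import Data.Nat as ℕ using (ℕ; zero; suc)
import Data.Nat.Properties as ℕₚ
import Data.Nat.Coprimality as Coprimality
import Data.Integer as ℤ
import Data.Integer.Properties as ℤₚ
open import Data.Bool using (Bool; true; false; if_then_else_; T)
open import Data.Bool.Properties using (if-float; if-eta)
open import Data.Unit using (tt)
open import Data.Empty using (⊥-elim)
open import Data.Fin as Fin using (Fin; toℕ)
import Data.Fin.Properties as Finₚ
import Data.Vec.Functional as Vector
open import Data.List using (List; []; _∷_; map; concatMap; applyUpTo; allFin; filter; length)
open import Data.List.Properties using (map-cong; length-applyUpTo)
open import Data.List.Relation.Unary.All as All using (All)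
open import Data.List.Relation.Unary.All.Properties using (all-filter; applyUpTo⁺₂)
open import Data.List.Relation.Unary.Any as Any using (Any; here)
open import Data.List.Relation.Unary.Any.Properties using (concatMap⁺; map⁺; applyUpTo⁺)
open import Data.List.Membership.Propositional using (_∈_; find)
open import Data.List.Membership.Propositional.Properties using (∈-filter⁺)
import Data.List.Extrema
open import Data.Rational
open import Data.Rational.Properties
open import Data.Rational.Solver using (module +-*-Solver)
open import Data.Product using (Σ; ∃; _×_; _,_; proj₁; proj₂)
open import Data.Sum using (_⊎_; inj₁; inj₂; [_,_]′)
open import Function using (id)
open import Relation.Nullary using (Dec; yes; no; ¬?)
open import Relation.Nullary.Decidable using (_×-dec_; _⊎-dec_; _→-dec_)
open import Relation.Unary using (Decidable)
open import Relation.Binary.Bundles using (DecTotalOrder)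
open import Relation.Binary.PropositionalEquality

open +-*-Solver

0≤1 : 0ℚ ≤ 1ℚ
0≤1 = *≤* (ℤ.+≤+ ℕ.z≤n)

0<1 : 0ℚ < 1ℚ
0<1 = *<* (ℤ.+<+ (ℕ.s≤s ℕ.z≤n))

0≤q-p⇒p≤q : ∀ {p q} → 0ℚ ≤ q - p → p ≤ q
0≤q-p⇒p≤q {p} {q} h = subst₂ _≤_ (+-identityʳ p) p+[q-p]≡q (+-monoʳ-≤ p h)
  where
  p+[q-p]≡q : p + (q - p) ≡ q
  p+[q-p]≡q = solve 2 (λ p q → p :+ (q :- p) := q) refl p q

p≤q⇒0≤q-p : ∀ {p q} → p ≤ q → 0ℚ ≤ q - p
p≤q⇒0≤q-p {p} {q} p≤q = subst (_≤ q - p) (+-inverseʳ p) (+-monoˡ-≤ (- p) p≤q)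

≤-byDifference : ∀ {p q} r → q - p ≡ r → 0ℚ ≤ r → p ≤ q
≤-byDifference r q-p≡r 0≤r = 0≤q-p⇒p≤q (subst (0ℚ ≤_) (sym q-p≡r) 0≤r)

+-nonNeg : ∀ {p q} → 0ℚ ≤ p → 0ℚ ≤ q → 0ℚ ≤ p + q
+-nonNeg = +-mono-≤

*-nonNeg : ∀ {p q} → 0ℚ ≤ p → 0ℚ ≤ q → 0ℚ ≤ p * q
*-nonNeg {p} {q} 0≤p 0≤q =
  nonNegative⁻¹ _ {{nonNeg*nonNeg⇒nonNeg p {{nonNegative 0≤p}} q {{nonNegative 0≤q}}}}

*-pos : ∀ {p q} → 0ℚ < p → 0ℚ < q → 0ℚ < p * q
*-pos {p} {q} 0<p 0<q = positive⁻¹ _ {{pos*pos⇒pos p {{positive 0<p}} q {{positive 0<q}}}}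

*-monoʳ-≤′ : ∀ {r p q} → 0ℚ ≤ r → p ≤ q → r * p ≤ r * q
*-monoʳ-≤′ {r} 0≤r = *-monoˡ-≤-nonNeg r {{nonNegative 0≤r}}

*-monoˡ-≤′ : ∀ {r p q} → 0ℚ ≤ r → p ≤ q → p * r ≤ q * r
*-monoˡ-≤′ {r} 0≤r = *-monoʳ-≤-nonNeg r {{nonNegative 0≤r}}

*-cancelˡ-≤′ : ∀ {r p q} → 0ℚ < r → r * p ≤ r * q → p ≤ q
*-cancelˡ-≤′ {r} 0<r = *-cancelˡ-≤-pos r {{positive 0<r}}

*-≤1 : ∀ {p q} → 0ℚ ≤ p → p ≤ 1ℚ → q ≤ 1ℚ → p * q ≤ 1ℚ
*-≤1 {p} 0≤p p≤1 q≤1 = ≤-trans (*-monoʳ-≤′ 0≤p q≤1) (subst (_≤ 1ℚ) (sym (*-identityʳ p)) p≤1)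

1+-pos : ∀ {p} → 0ℚ ≤ p → 0ℚ < 1ℚ + p
1+-pos = +-mono-<-≤ 0<1

ℕtoℚ≡mkℚ : ∀ m → ℕtoℚ m ≡ mkℚ (ℤ.+ m) 0 (Coprimality.sym (Coprimality.1-coprimeTo m))
ℕtoℚ≡mkℚ m = normalize-coprime (Coprimality.sym (Coprimality.1-coprimeTo m))

ℕtoℚ-suc : ∀ m → ℕtoℚ (suc m) ≡ 1ℚ + ℕtoℚ m
ℕtoℚ-suc m rewrite ℕtoℚ≡mkℚ m =
  /-cong (cong (ℤ._+_ (ℤ.+ 1)) (sym (ℤₚ.*-identityʳ (ℤ.+ m)))) refl

ℕtoℚ-homo-+ : ∀ a b → ℕtoℚ (a ℕ.+ b) ≡ ℕtoℚ a + ℕtoℚ b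
ℕtoℚ-homo-+ zero b = sym (+-identityˡ (ℕtoℚ b))
ℕtoℚ-homo-+ (suc a) b = begin
  ℕtoℚ (suc (a ℕ.+ b))       ≡⟨ ℕtoℚ-suc (a ℕ.+ b) ⟩
  1ℚ + ℕtoℚ (a ℕ.+ b)        ≡⟨ cong (1ℚ +_) (ℕtoℚ-homo-+ a b) ⟩
  1ℚ + (ℕtoℚ a + ℕtoℚ b)     ≡⟨ sym (+-assoc 1ℚ (ℕtoℚ a) (ℕtoℚ b)) ⟩
  (1ℚ + ℕtoℚ a) + ℕtoℚ b     ≡⟨ cong (_+ ℕtoℚ b) (sym (ℕtoℚ-suc a)) ⟩
  ℕtoℚ (suc a) + ℕtoℚ b      ∎
  where open ≡-Reasoning

ℕtoℚ-nonNeg : ∀ m → 0ℚ ≤ ℕtoℚ m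
ℕtoℚ-nonNeg m = nonNegative⁻¹ (ℕtoℚ m) {{normalize-nonNeg m 1}}

ℕtoℚ-pos : ∀ m → 0ℚ < ℕtoℚ (suc m)
ℕtoℚ-pos m = positive⁻¹ (ℕtoℚ (suc m)) {{normalize-pos (suc m) 1}}

ℕtoℚ-mono-≤ : ∀ {a b} → a ℕ.≤ b → ℕtoℚ a ≤ ℕtoℚ b
ℕtoℚ-mono-≤ {a} a≤b with ℕₚ.m≤n⇒∃[o]m+o≡n a≤b
... | o , refl = subst₂ _≤_ (+-identityʳ (ℕtoℚ a)) (sym (ℕtoℚ-homo-+ a o))
                   (+-monoʳ-≤ (ℕtoℚ a) (ℕtoℚ-nonNeg o))

ℕtoℚ-suc-nonZero : ∀ m → NonZero (ℕtoℚ (suc m))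
ℕtoℚ-suc-nonZero m = pos⇒nonZero (ℕtoℚ (suc m)) {{positive (ℕtoℚ-pos m)}}

-- Opaque because unfolding ℕtoℚ makes the type checker normalise symbolic gcd computations.
opaque
  ⅟ : ℕ → ℚ
  ⅟ m = (1/ ℕtoℚ (suc m)) {{ℕtoℚ-suc-nonZero m}}

  ⅟-pos : ∀ m → 0ℚ < ⅟ m
  ⅟-pos m = positive⁻¹ (⅟ m) {{1/pos⇒pos (ℕtoℚ (suc m)) {{positive (ℕtoℚ-pos m)}}}}

  ℕtoℚ*⅟ : ∀ m → ℕtoℚ (suc m) * ⅟ m ≡ 1ℚ
  ℕtoℚ*⅟ m = *-inverseʳ (ℕtoℚ (suc m)) {{ℕtoℚ-suc-nonZero m}}

mkℚ≤ℕtoℚ : ∀ m d .(c : Coprimality.Coprime m (suc d)) → mkℚ (ℤ.+ m) d c ≤ ℕtoℚ m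
mkℚ≤ℕtoℚ m d c rewrite ℕtoℚ≡mkℚ m =
  *≤* (subst₂ ℤ._≤_ (ℤₚ.pos-* m 1) (ℤₚ.pos-* m (suc d)) (ℤ.+≤+ (ℕₚ.*-monoʳ-≤ m (ℕ.s≤s ℕ.z≤n))))

-- For q = (a+1)/(d+1) we have 1/q = (d+1)/(a+1) ≤ d + 1.
⅟-below : ∀ q → 0ℚ < q → ∃ λ m → ⅟ m ≤ q
⅟-below q@(mkℚ (ℤ.+ suc a) d c) 0<q = d , (begin
  ⅟ d                      ≡⟨ sym (*-identityʳ (⅟ d)) ⟩
  ⅟ d * 1ℚ                 ≡⟨ cong (⅟ d *_) (sym (*-inverseʳ q)) ⟩
  ⅟ d * (q * 1/ q)         ≤⟨ *-monoʳ-≤′ (<⇒≤ (⅟-pos d))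
                                (*-monoʳ-≤′ (<⇒≤ 0<q) (mkℚ≤ℕtoℚ (suc d) a (Coprimality.sym c))) ⟩
  ⅟ d * (q * N)            ≡⟨ solve 3 (λ i q N → i :* (q :* N) := q :* (N :* i)) refl (⅟ d) q N ⟩
  q * (N * ⅟ d)            ≡⟨ cong (q *_) (ℕtoℚ*⅟ d) ⟩
  q * 1ℚ                   ≡⟨ *-identityʳ q ⟩
  q                        ∎)
  where
  open ≤-Reasoning
  N : ℚ
  N = ℕtoℚ (suc d)
  instance
    q≢0 : NonZero q
    q≢0 = pos⇒nonZero q {{positive 0<q}}
⅟-below (mkℚ (ℤ.+ zero) d c) (*<* (ℤ.+<+ ()))
⅟-below (mkℚ ℤ.-[1+ a ] d c) (*<* ())

^-nonNeg : ∀ {q} k → 0ℚ ≤ q → 0ℚ ≤ q ^ℚ k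
^-nonNeg zero    0≤q = 0≤1
^-nonNeg (suc k) 0≤q = *-nonNeg 0≤q (^-nonNeg k 0≤q)

^-pos : ∀ {q} k → 0ℚ < q → 0ℚ < q ^ℚ k
^-pos zero    0<q = 0<1
^-pos (suc k) 0<q = *-pos 0<q (^-pos k 0<q)

^-≤1 : ∀ {q} k → 0ℚ ≤ q → q ≤ 1ℚ → q ^ℚ k ≤ 1ℚ
^-≤1 zero    0≤q q≤1 = ≤-refl
^-≤1 (suc k) 0≤q q≤1 = *-≤1 0≤q q≤1 (^-≤1 k 0≤q q≤1)

^-monoˡ-≤ : ∀ {p q} k → 0ℚ ≤ p → p ≤ q → p ^ℚ k ≤ q ^ℚ k
^-monoˡ-≤ zero    0≤p p≤q = ≤-refl
^-monoˡ-≤ {p} {q} (suc k) 0≤p p≤q =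
  ≤-trans (*-monoʳ-≤′ 0≤p (^-monoˡ-≤ k 0≤p p≤q))
          (*-monoˡ-≤′ (^-nonNeg k (≤-trans 0≤p p≤q)) p≤q)

^-distribʳ-* : ∀ p q k → (p * q) ^ℚ k ≡ p ^ℚ k * q ^ℚ k
^-distribʳ-* p q zero    = refl
^-distribʳ-* p q (suc k) rewrite ^-distribʳ-* p q k =
  solve 4 (λ p q x y → (p :* q) :* (x :* y) := (p :* x) :* (q :* y)) refl p q (p ^ℚ k) (q ^ℚ k)

bernoulli : ∀ {x} j → 0ℚ ≤ x → (1ℚ + x) ^ℚ j * (1ℚ - ℕtoℚ j * x) ≤ 1ℚ
bernoulli {x} zero    0≤x = ≤-reflexive (solve 1 (λ x → con 1ℚ :* (con 1ℚ :- con 0ℚ :* x) := con 1ℚ) refl x)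
bernoulli {x} (suc j) 0≤x = ≤-trans step (bernoulli j 0≤x)
  where
  P e : ℚ
  P = (1ℚ + x) ^ℚ j
  e = ℕtoℚ j
  step : (1ℚ + x) * P * (1ℚ - ℕtoℚ (suc j) * x) ≤ P * (1ℚ - e * x)
  step rewrite ℕtoℚ-suc j = ≤-byDifference (P * (1ℚ + e) * x * x)
    (solve 3 (λ P e x → P :* (con 1ℚ :- e :* x) :- (con 1ℚ :+ x) :* P :* (con 1ℚ :- (con 1ℚ :+ e) :* x)
                        := P :* (con 1ℚ :+ e) :* x :* x) refl P e x)
    (*-nonNeg (*-nonNeg (*-nonNeg (^-nonNeg j (+-nonNeg 0≤1 0≤x)) (+-nonNeg 0≤1 (ℕtoℚ-nonNeg j))) 0≤x) 0≤x)

-- With K = k + 1 we have ⅟ (k + K) = 1/(2K), and Bernoulli gives (1 + 1/(2K))^K · 1/2 ≤ 1.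
[1+1/2K]^K≤2 : ∀ k → (1ℚ + ⅟ (k ℕ.+ suc k)) ^ℚ suc k ≤ ℕtoℚ 2
[1+1/2K]^K≤2 k = subst (_≤ ℕtoℚ 2) P[1-t]+P[1-t]≡P (+-mono-≤ bound bound)
  where
  δ P t : ℚ
  δ = ⅟ (k ℕ.+ suc k)
  P = (1ℚ + δ) ^ℚ suc k
  t = ℕtoℚ (suc k) * δ
  bound : P * (1ℚ - t) ≤ 1ℚ
  bound = bernoulli (suc k) (<⇒≤ (⅟-pos (k ℕ.+ suc k)))
  t+t≡1 : t + t ≡ 1ℚ
  t+t≡1 = trans (sym (*-distribʳ-+ δ (ℕtoℚ (suc k)) (ℕtoℚ (suc k))))
                (trans (cong (_* δ) (sym (ℕtoℚ-homo-+ (suc k) (suc k)))) (ℕtoℚ*⅟ (k ℕ.+ suc k)))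
  P[1-t]+P[1-t]≡P : P * (1ℚ - t) + P * (1ℚ - t) ≡ P
  P[1-t]+P[1-t]≡P = begin
    P * (1ℚ - t) + P * (1ℚ - t)  ≡⟨ solve 2 (λ P t → P :* (con 1ℚ :- t) :+ P :* (con 1ℚ :- t)
                                               := P :* (con 1ℚ :+ con 1ℚ :- (t :+ t))) refl P t ⟩
    P * (1ℚ + 1ℚ - (t + t))      ≡⟨ cong (λ s → P * (1ℚ + 1ℚ - s)) t+t≡1 ⟩
    P * 1ℚ                       ≡⟨ *-identityʳ P ⟩
    P                            ∎
    where open ≡-Reasoning

module _ {A : Set} where

  sumℚ-mono-≤ : ∀ xs {f g : A → ℚ} → (∀ x → f x ≤ g x) → sumℚ (map f xs) ≤ sumℚ (map g xs)
  sumℚ-mono-≤ []       f≤g = ≤-refl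
  sumℚ-mono-≤ (x ∷ xs) f≤g = +-mono-≤ (f≤g x) (sumℚ-mono-≤ xs f≤g)

  sumℚ-homo-+ : ∀ xs (f g : A → ℚ) →
                sumℚ (map (λ x → f x + g x) xs) ≡ sumℚ (map f xs) + sumℚ (map g xs)
  sumℚ-homo-+ []       f g = refl
  sumℚ-homo-+ (x ∷ xs) f g rewrite sumℚ-homo-+ xs f g =
    solve 4 (λ a b c d → (a :+ b) :+ (c :+ d) := (a :+ c) :+ (b :+ d)) refl
      (f x) (g x) (sumℚ (map f xs)) (sumℚ (map g xs))

  sumℚ-homo-* : ∀ xs c (f : A → ℚ) → sumℚ (map (λ x → c * f x) xs) ≡ c * sumℚ (map f xs)
  sumℚ-homo-* []       c f = sym (*-zeroʳ c)
  sumℚ-homo-* (x ∷ xs) c f rewrite sumℚ-homo-* xs c f = sym (*-distribˡ-+ c (f x) (sumℚ (map f xs)))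

module _ {n : ℕ} where

  private
    guard : Fin n → Fin n → ℚ → ℚ
    guard i j v = if toℕ i ℕ.<ᵇ toℕ j then v else 0ℚ

    rows : (Fin n → Fin n → ℚ) → Fin n → ℚ
    rows f i = sumℚ (map (λ j → guard i j (f i j)) (allFin n))

  pairSum-mono-≤ : ∀ {f g : Fin n → Fin n → ℚ} → (∀ i j → toℕ i ℕ.< toℕ j → f i j ≤ g i j) →
                   pairSum f ≤ pairSum g
  pairSum-mono-≤ {f} {g} f≤g = sumℚ-mono-≤ (allFin n) λ i → sumℚ-mono-≤ (allFin n) λ j →
    guarded i j (toℕ i ℕ.<ᵇ toℕ j) (ℕₚ.<ᵇ⇒< (toℕ i) (toℕ j))
    where
    guarded : ∀ i j b → (T b → toℕ i ℕ.< toℕ j) →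
              (if b then f i j else 0ℚ) ≤ (if b then g i j else 0ℚ)
    guarded i j true  i<j = f≤g i j (i<j tt)
    guarded i j false _   = ≤-refl

  pairSum-homo-+ : ∀ (f g : Fin n → Fin n → ℚ) → pairSum (λ i j → f i j + g i j) ≡ pairSum f + pairSum g
  pairSum-homo-+ f g = begin
    sumℚ (map (rows (λ i j → f i j + g i j)) (allFin n))
      ≡⟨ cong sumℚ (map-cong (λ i → trans
           (cong sumℚ (map-cong (λ j → guard-+ (toℕ i ℕ.<ᵇ toℕ j)) (allFin n)))
           (sumℚ-homo-+ (allFin n) _ _)) (allFin n)) ⟩
    sumℚ (map (λ i → rows f i + rows g i) (allFin n))
      ≡⟨ sumℚ-homo-+ (allFin n) (rows f) (rows g) ⟩
    pairSum f + pairSum g ∎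
    where
    open ≡-Reasoning
    guard-+ : ∀ b {x y} → (if b then x + y else 0ℚ) ≡ (if b then x else 0ℚ) + (if b then y else 0ℚ)
    guard-+ true  = refl
    guard-+ false = refl

  pairSum-homo-* : ∀ c (f : Fin n → Fin n → ℚ) → pairSum (λ i j → c * f i j) ≡ c * pairSum f
  pairSum-homo-* c f = begin
    sumℚ (map (rows (λ i j → c * f i j)) (allFin n))
      ≡⟨ cong sumℚ (map-cong (λ i → trans
           (cong sumℚ (map-cong (λ j → guard-* (toℕ i ℕ.<ᵇ toℕ j)) (allFin n)))
           (sumℚ-homo-* (allFin n) c _)) (allFin n)) ⟩
    sumℚ (map (λ i → c * rows f i) (allFin n))
      ≡⟨ sumℚ-homo-* (allFin n) c (rows f) ⟩
    c * pairSum f ∎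
    where
    open ≡-Reasoning
    guard-* : ∀ b {x} → (if b then c * x else 0ℚ) ≡ c * (if b then x else 0ℚ)
    guard-* true  = refl
    guard-* false = sym (*-zeroʳ c)

  pairSum-nonNeg : ∀ {f : Fin n → Fin n → ℚ} → (∀ i j → toℕ i ℕ.< toℕ j → 0ℚ ≤ f i j) → 0ℚ ≤ pairSum f
  pairSum-nonNeg {f} 0≤f = subst (_≤ pairSum f) pairSum-zero (pairSum-mono-≤ 0≤f)
    where
    pairSum-zero : pairSum {n} (λ _ _ → 0ℚ) ≡ 0ℚ
    pairSum-zero = trans (pairSum-homo-* 0ℚ (λ _ _ → 0ℚ)) (*-zeroˡ (pairSum {n} (λ _ _ → 0ℚ)))

InUnitCube : ∀ {n} → Sol n → Set
InUnitCube {n} x = ∀ (i j : Fin n) → toℕ i ℕ.< toℕ j → (0ℚ ≤ x i j) × (x i j ≤ 1ℚ)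

indicator : Bool → ℚ
indicator e = if e then 1ℚ else 0ℚ

pairCost : Bool → ℚ → ℚ → ℚ
pairCost e λ' v = (if e then v else 0ℚ) + λ' * (1ℚ - v)

module _ {λ' v : ℚ} where

  pairCost-nonNeg : ∀ e → 0ℚ ≤ λ' → 0ℚ ≤ v → v ≤ 1ℚ → 0ℚ ≤ pairCost e λ' v
  pairCost-nonNeg true  0≤λ 0≤v v≤1 = +-nonNeg 0≤v (*-nonNeg 0≤λ (p≤q⇒0≤q-p v≤1))
  pairCost-nonNeg false 0≤λ 0≤v v≤1 = +-nonNeg ≤-refl (*-nonNeg 0≤λ (p≤q⇒0≤q-p v≤1))

  pairCost-monoˡ-≤ : ∀ e {μ} → v ≤ 1ℚ → μ ≤ λ' → pairCost e μ v ≤ pairCost e λ' v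
  pairCost-monoˡ-≤ e v≤1 μ≤λ = +-monoʳ-≤ (if e then v else 0ℚ) (*-monoˡ-≤′ (p≤q⇒0≤q-p v≤1) μ≤λ)

  pairCost-scale : ∀ e {μ} → 0ℚ ≤ v → μ ≤ λ' → μ * pairCost e λ' v ≤ λ' * pairCost e μ v
  pairCost-scale e {μ} 0≤v μ≤λ = ≤-byDifference ((λ' - μ) * a)
    (solve 4 (λ a v l m → l :* (a :+ m :* (con 1ℚ :- v)) :- m :* (a :+ l :* (con 1ℚ :- v))
                          := (l :- m) :* a) refl a v λ' μ)
    (*-nonNeg (p≤q⇒0≤q-p μ≤λ) (edgePart-nonNeg e))
    where
    a : ℚ
    a = if e then v else 0ℚ
    edgePart-nonNeg : ∀ e → 0ℚ ≤ (if e then v else 0ℚ)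
    edgePart-nonNeg true  = 0≤v
    edgePart-nonNeg false = ≤-refl

  pairCost-lowerBound : ∀ e → 0ℚ ≤ λ' → λ' ≤ 1ℚ → 0ℚ ≤ v → v ≤ 1ℚ → λ' * indicator e ≤ pairCost e λ' v
  pairCost-lowerBound true  0≤λ λ≤1 0≤v v≤1 = ≤-byDifference (v * (1ℚ - λ'))
    (solve 2 (λ v l → (v :+ l :* (con 1ℚ :- v)) :- l :* con 1ℚ := v :* (con 1ℚ :- l)) refl v λ')
    (*-nonNeg 0≤v (p≤q⇒0≤q-p λ≤1))
  pairCost-lowerBound false 0≤λ λ≤1 0≤v v≤1 = ≤-byDifference (λ' * (1ℚ - v))
    (solve 2 (λ v l → (con 0ℚ :+ l :* (con 1ℚ :- v)) :- l :* con 0ℚ := l :* (con 1ℚ :- v)) refl v λ')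
    (*-nonNeg 0≤λ (p≤q⇒0≤q-p v≤1))

  pairCost-perturb : ∀ e {v′ w} → 0ℚ ≤ λ' → v ≤ v′ → v′ ≤ v + w →
                     pairCost e λ' v′ ≤ pairCost e λ' v + w * indicator e
  pairCost-perturb true  {v′} {w} 0≤λ v≤v′ v′≤v+w = ≤-byDifference ((v + w - v′) + λ' * (v′ - v))
    (solve 4 (λ v v′ l w → ((v :+ l :* (con 1ℚ :- v)) :+ w :* con 1ℚ) :- (v′ :+ l :* (con 1ℚ :- v′))
                           := (v :+ w :- v′) :+ l :* (v′ :- v)) refl v v′ λ' w)
    (+-nonNeg (p≤q⇒0≤q-p v′≤v+w) (*-nonNeg 0≤λ (p≤q⇒0≤q-p v≤v′)))
  pairCost-perturb false {v′} {w} 0≤λ v≤v′ v′≤v+w = ≤-byDifference (λ' * (v′ - v))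
    (solve 4 (λ v v′ l w → ((con 0ℚ :+ l :* (con 1ℚ :- v)) :+ w :* con 0ℚ) :- (con 0ℚ :+ l :* (con 1ℚ :- v′))
                           := l :* (v′ :- v)) refl v v′ λ' w)
    (*-nonNeg 0≤λ (p≤q⇒0≤q-p v≤v′))

module _ {n : ℕ} (G : Graph n) where

  open Graph G using (adj)

  edges : Fin n → Fin n → ℚ
  edges i j = indicator (adj i j)

  edgeCount : ℚ
  edgeCount = pairSum edges

  costs : ℚ → Sol n → Fin n → Fin n → ℚ
  costs λ' x i j = pairCost (adj i j) λ' (x i j)

  objective-pairCost : ∀ λ' x → objective G λ' x ≡ pairSum (costs λ' x)
  objective-pairCost λ' x = sym (pairSum-homo-+ (λ i j → if adj i j then x i j else 0ℚ) (λ i j → λ' * (1ℚ - x i j)))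

  edgeCount-nonNeg : 0ℚ ≤ edgeCount
  edgeCount-nonNeg = pairSum-nonNeg λ i j _ → indicator-nonNeg (adj i j)
    where
    indicator-nonNeg : ∀ e → 0ℚ ≤ indicator e
    indicator-nonNeg true  = 0≤1
    indicator-nonNeg false = ≤-refl

  objective-nonNeg : ∀ {λ' x} → 0ℚ ≤ λ' → InUnitCube x → 0ℚ ≤ objective G λ' x
  objective-nonNeg {λ'} {x} 0≤λ x∈cube = subst (0ℚ ≤_) (sym (objective-pairCost λ' x))
    (pairSum-nonNeg λ i j i<j → pairCost-nonNeg (adj i j) 0≤λ (proj₁ (x∈cube i j i<j)) (proj₂ (x∈cube i j i<j)))

  objective-monoˡ-≤ : ∀ {μ λ' x} → InUnitCube x → μ ≤ λ' → objective G μ x ≤ objective G λ' x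
  objective-monoˡ-≤ {μ} {λ'} {x} x∈cube μ≤λ = subst₂ _≤_ (sym (objective-pairCost μ x)) (sym (objective-pairCost λ' x))
    (pairSum-mono-≤ λ i j i<j → pairCost-monoˡ-≤ (adj i j) (proj₂ (x∈cube i j i<j)) μ≤λ)

  -- The objective is affine in λ with nonnegative intercept, so λ ↦ objective λ x / λ is antitone.
  objective-scale : ∀ {μ λ' x} → InUnitCube x → μ ≤ λ' → μ * objective G λ' x ≤ λ' * objective G μ x
  objective-scale {μ} {λ'} {x} x∈cube μ≤λ = begin
    μ * objective G λ' x                  ≡⟨ cong (μ *_) (objective-pairCost λ' x) ⟩
    μ * pairSum (costs λ' x)              ≡⟨ sym (pairSum-homo-* μ (costs λ' x)) ⟩
    pairSum (λ i j → μ * costs λ' x i j)  ≤⟨ pairSum-mono-≤ (λ i j i<j →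
                                               pairCost-scale (adj i j) (proj₁ (x∈cube i j i<j)) μ≤λ) ⟩
    pairSum (λ i j → λ' * costs μ x i j)  ≡⟨ pairSum-homo-* λ' (costs μ x) ⟩
    λ' * pairSum (costs μ x)              ≡⟨ cong (λ' *_) (sym (objective-pairCost μ x)) ⟩
    λ' * objective G μ x                  ∎
    where open ≤-Reasoning

  objective-lowerBound : ∀ {λ' x} → 0ℚ ≤ λ' → λ' ≤ 1ℚ → InUnitCube x → λ' * edgeCount ≤ objective G λ' x
  objective-lowerBound {λ'} {x} 0≤λ λ≤1 x∈cube =
    subst₂ _≤_ (pairSum-homo-* λ' edges) (sym (objective-pairCost λ' x))
      (pairSum-mono-≤ λ i j i<j →
        pairCost-lowerBound (adj i j) 0≤λ λ≤1 (proj₁ (x∈cube i j i<j)) (proj₂ (x∈cube i j i<j)))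

  objective-perturb : ∀ {λ' w} {y z : Sol n} → 0ℚ ≤ λ' →
                      (∀ i j → toℕ i ℕ.< toℕ j → (y i j ≤ z i j) × (z i j ≤ y i j + w)) →
                      objective G λ' z ≤ objective G λ' y + w * edgeCount
  objective-perturb {λ'} {w} {y} {z} 0≤λ y≤z≤y+w = begin
    objective G λ' z                                        ≡⟨ objective-pairCost λ' z ⟩
    pairSum (costs λ' z)                                    ≤⟨ pairSum-mono-≤ (λ i j i<j →
                                                                 pairCost-perturb (adj i j) 0≤λ
                                                                   (proj₁ (y≤z≤y+w i j i<j)) (proj₂ (y≤z≤y+w i j i<j))) ⟩
    pairSum (λ i j → costs λ' y i j + w * edges i j)        ≡⟨ pairSum-homo-+ (costs λ' y) (λ i j → w * edges i j) ⟩
    pairSum (costs λ' y) + pairSum (λ i j → w * edges i j)  ≡⟨ cong₂ _+_ (sym (objective-pairCost λ' y))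
                                                                        (pairSum-homo-* w edges) ⟩
    objective G λ' y + w * edgeCount                        ∎
    where open ≤-Reasoning

-- Rounding up to the grid {0, w, 2w, …, 1} of mesh w = 1/(m+1)

module Grid (m : ℕ) where

  w : ℚ
  w = ⅟ m

  -- Opaque for the same reason as ⅟.
  opaque
    point : ℕ → ℚ
    point k = ℕtoℚ k * w

    point-zero : point 0 ≡ 0ℚ
    point-zero = *-zeroˡ w

    point-suc : ∀ k → point (suc k) ≡ point k + w
    point-suc k = begin
      ℕtoℚ (suc k) * w        ≡⟨ cong (_* w) (trans (ℕtoℚ-suc k) (+-comm 1ℚ (ℕtoℚ k))) ⟩
      (ℕtoℚ k + 1ℚ) * w       ≡⟨ *-distribʳ-+ w (ℕtoℚ k) 1ℚ ⟩
      point k + 1ℚ * w        ≡⟨ cong (point k +_) (*-identityˡ w) ⟩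
      point k + w             ∎
      where open ≡-Reasoning

    point-homo-+ : ∀ a b → point (a ℕ.+ b) ≡ point a + point b
    point-homo-+ a b = trans (cong (_* w) (ℕtoℚ-homo-+ a b)) (*-distribʳ-+ w (ℕtoℚ a) (ℕtoℚ b))

    point-nonNeg : ∀ k → 0ℚ ≤ point k
    point-nonNeg k = *-nonNeg (ℕtoℚ-nonNeg k) (<⇒≤ (⅟-pos m))

    point-mono-≤ : ∀ {a b} → a ℕ.≤ b → point a ≤ point b
    point-mono-≤ a≤b = *-monoˡ-≤′ (<⇒≤ (⅟-pos m)) (ℕtoℚ-mono-≤ a≤b)

    point-top : point (suc m) ≡ 1ℚ
    point-top = ℕtoℚ*⅟ m

  point-≤1 : ∀ {k} → k ℕ.≤ suc m → point k ≤ 1ℚ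
  point-≤1 {k} k≤M = subst (point k ≤_) point-top (point-mono-≤ k≤M)

  -- index K y is the least k ≤ K with y ≤ point k, and K if there is none.
  index : ℕ → ℚ → ℕ
  index zero    y = zero
  index (suc k) y with y ≤? point k
  ... | yes _ = index k y
  ... | no  _ = suc k

  index-≤ : ∀ K y → index K y ℕ.≤ K
  index-≤ zero    y = ℕ.z≤n
  index-≤ (suc k) y with y ≤? point k
  ... | yes _ = ℕₚ.m≤n⇒m≤1+n (index-≤ k y)
  ... | no  _ = ℕₚ.≤-refl

  ≤-point-index : ∀ K {y} → y ≤ point K → y ≤ point (index K y)
  ≤-point-index zero    y≤pK = y≤pK
  ≤-point-index (suc k) {y} y≤pK with y ≤? point k
  ... | yes y≤pk = ≤-point-index k y≤pk
  ... | no  _    = y≤pK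

  index-minimal : ∀ K {y i} → y ≤ point i → index K y ℕ.≤ i
  index-minimal zero    y≤pi = ℕ.z≤n
  index-minimal (suc k) {y} {i} y≤pi with y ≤? point k
  ... | yes _    = index-minimal k y≤pi
  ... | no  y≰pk = ℕₚ.≰⇒> (λ i≤k → y≰pk (≤-trans y≤pi (point-mono-≤ i≤k)))

  point-index-≤ : ∀ K {y} → 0ℚ ≤ y → point (index K y) ≤ y + w
  point-index-≤ zero    {y} 0≤y = subst (_≤ y + w) (sym point-zero) (+-nonNeg 0≤y (<⇒≤ (⅟-pos m)))
  point-index-≤ (suc k) {y} 0≤y with y ≤? point k
  ... | yes _    = point-index-≤ k 0≤y
  ... | no  y≰pk = subst (_≤ y + w) (sym (point-suc k)) (+-monoˡ-≤ w (<⇒≤ (≰⇒> y≰pk)))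

  roundUp : ℚ → ℚ
  roundUp y = point (index (suc m) y)

  roundUp-≥ : ∀ {y} → y ≤ 1ℚ → y ≤ roundUp y
  roundUp-≥ {y} y≤1 = ≤-point-index (suc m) (subst (y ≤_) (sym point-top) y≤1)

  roundUp-≤ : ∀ {y} → 0ℚ ≤ y → roundUp y ≤ y + w
  roundUp-≤ = point-index-≤ (suc m)

  roundUp-nonNeg : ∀ y → 0ℚ ≤ roundUp y
  roundUp-nonNeg y = point-nonNeg (index (suc m) y)

  roundUp-≤1 : ∀ y → roundUp y ≤ 1ℚ
  roundUp-≤1 y = point-≤1 (index-≤ (suc m) y)

  roundUp-subadditive : ∀ {a b c} → a ≤ b + c → b ≤ 1ℚ → c ≤ 1ℚ → roundUp a ≤ roundUp b + roundUp c
  roundUp-subadditive {a} {b} {c} a≤b+c b≤1 c≤1 =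
    subst (roundUp a ≤_) (point-homo-+ (index (suc m) b) (index (suc m) c))
      (point-mono-≤ (index-minimal (suc m)
        (≤-trans a≤b+c (subst (b + c ≤_) (sym (point-homo-+ (index (suc m) b) (index (suc m) c)))
          (+-mono-≤ (roundUp-≥ b≤1) (roundUp-≥ c≤1))))))

  roundUp-0 : roundUp 0ℚ ≡ 0ℚ
  roundUp-0 = trans (cong point (ℕₚ.n≤0⇒n≡0 (index-minimal (suc m) (≤-reflexive (sym point-zero)))))
                    point-zero

  roundUp-1 : roundUp 1ℚ ≡ 1ℚ
  roundUp-1 = ≤-antisym (roundUp-≤1 1ℚ) (roundUp-≥ ≤-refl)

  points : List ℚ
  points = applyUpTo point (suc (suc m))

  roundUp∈points : ∀ y → Any (_≡ roundUp y) points
  roundUp∈points y = applyUpTo⁺ point refl (ℕ.s≤s (index-≤ (suc m) y))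

allFunctions : ∀ {A : Set} n → List A → List (Fin n → A)
allFunctions zero    xs = (λ ()) ∷ []
allFunctions (suc n) xs = concatMap (λ x → map (x Vector.∷_) (allFunctions n xs)) xs

allFunctions-complete : ∀ {A B : Set} (R : A → B → Set) n {xs : List B} (f : Fin n → A) →
                        (∀ i → Any (R (f i)) xs) → Any (λ g → ∀ i → R (f i) (g i)) (allFunctions n xs)
allFunctions-complete R zero    f covered = here (λ ())
allFunctions-complete R (suc n) f covered =
  concatMap⁺ (λ x → map (x Vector.∷_) (allFunctions n _))
    (Any.map (λ r → map⁺ (Any.map (cons r) rest)) (covered Fin.zero))
  where
  rest : Any (λ g → ∀ i → R (f (Fin.suc i)) (g i)) (allFunctions n _)
  rest = allFunctions-complete R n (λ i → f (Fin.suc i)) (λ i → covered (Fin.suc i))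
  cons : ∀ {x g} → R (f Fin.zero) x → (∀ i → R (f (Fin.suc i)) (g i)) → ∀ i → R (f i) ((x Vector.∷ g) i)
  cons r rs Fin.zero    = r
  cons r rs (Fin.suc i) = rs i

gridSolutions : ∀ {n} → ℕ → List (Sol n)
gridSolutions {n} m = allFunctions n (allFunctions n (Grid.points m))

roundUp∈gridSolutions : ∀ {n} m (y : Sol n) →
                        Any (λ z → ∀ i j → z i j ≡ Grid.roundUp m (y i j)) (gridSolutions m)
roundUp∈gridSolutions {n} m y =
  allFunctions-complete (λ row row′ → ∀ j → row′ j ≡ row j) n (λ i j → Grid.roundUp m (y i j))
    (λ i → allFunctions-complete (λ a b → b ≡ a) n (λ j → Grid.roundUp m (y i j))
      (λ j → Grid.roundUp∈points m (y i j)))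

module _ {A : Set} (f : A → ℚ) {P : A → Set} (P? : Decidable P) where

  open Data.List.Extrema (DecTotalOrder.totalOrder ≤-decTotalOrder)

  minimiser : ∀ {d} → P d → (xs : List A) → ∃ λ x → P x × (∀ {y} → y ∈ xs → P y → f x ≤ f y)
  minimiser {d} Pd xs = argmin f d (filter P? xs)
                      , argmin-all f Pd (all-filter P? xs)
                      , λ y∈xs Py → All.lookup (f[argmin]≤f[xs] d (filter P? xs)) (∈-filter⁺ P? y∈xs Py)

module _ {n : ℕ} where

  val-map : ∀ {h : ℚ → ℚ} {y z : Sol n} → (∀ i j → z i j ≡ h (y i j)) → ∀ i j → val z i j ≡ h (val y i j)
  val-map {h} {y} z≡hy i j = trans (cong₂ (if toℕ i ℕ.<ᵇ toℕ j then_else_) (z≡hy i j) (z≡hy j i))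
                                   (sym (if-float h (toℕ i ℕ.<ᵇ toℕ j)))

  val-fromUpper : ∀ {P : ℚ → Set} {y : Sol n} → (∀ i j → toℕ i ℕ.< toℕ j → P (y i j)) →
              ∀ i j → i ≢ j → P (val y i j)
  val-fromUpper {P} {y} Py i j i≢j with toℕ i ℕ.<ᵇ toℕ j in i<ᵇj
  ... | true  = Py i j (ℕₚ.<ᵇ⇒< (toℕ i) (toℕ j) (subst T (sym i<ᵇj) tt))
  ... | false = Py j i (ℕₚ.≤∧≢⇒< (ℕₚ.≮⇒≥ (λ i<j → subst T i<ᵇj (ℕₚ.<⇒<ᵇ i<j)))
                                   (λ j≡i → i≢j (Finₚ.toℕ-injective (sym j≡i))))

  Triangle? : (x : Sol n) → Dec (Triangle x)
  Triangle? x = Finₚ.all? λ i → Finₚ.all? λ j → Finₚ.all? λ k →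
    ¬? (i Finₚ.≟ j) →-dec ¬? (i Finₚ.≟ k) →-dec ¬? (j Finₚ.≟ k) →-dec
    val x i j ≤? val x i k + val x j k

  private
    upperPairs? : ∀ {P : ℚ → Set} → Decidable P → (x : Sol n) →
                  Dec (∀ (i j : Fin n) → toℕ i ℕ.< toℕ j → P (x i j))
    upperPairs? P? x = Finₚ.all? λ i → Finₚ.all? λ j → (toℕ i ℕ.<? toℕ j) →-dec P? (x i j)

  LPFeasible? : (x : Sol n) → Dec (LPFeasible x)
  LPFeasible? x = Triangle? x ×-dec upperPairs? (λ q → (0ℚ ≤? q) ×-dec (q ≤? 1ℚ)) x

  ILPFeasible? : (x : Sol n) → Dec (ILPFeasible x)
  ILPFeasible? x = Triangle? x ×-dec upperPairs? (λ q → (q ≟ 0ℚ) ⊎-dec (q ≟ 1ℚ)) x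

  ILPFeasible⇒LPFeasible : ∀ {x : Sol n} → ILPFeasible x → LPFeasible x
  ILPFeasible⇒LPFeasible (triangle , binary) = triangle , λ i j i<j → bounds (binary i j i<j)
    where
    bounds : ∀ {q} → (q ≡ 0ℚ) ⊎ (q ≡ 1ℚ) → (0ℚ ≤ q) × (q ≤ 1ℚ)
    bounds (inj₁ refl) = ≤-refl , 0≤1
    bounds (inj₂ refl) = 0≤1 , ≤-refl

  ones : Sol n
  ones _ _ = 1ℚ

  ones-ILPFeasible : ILPFeasible ones
  ones-ILPFeasible = (λ i j k _ _ _ → subst₂ _≤_ (sym (if-eta (toℕ i ℕ.<ᵇ toℕ j) {1ℚ}))
                        (sym (cong₂ _+_ (if-eta (toℕ i ℕ.<ᵇ toℕ k) {1ℚ}) (if-eta (toℕ j ℕ.<ᵇ toℕ k) {1ℚ})))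
                        1≤1+1)
                   , λ _ _ _ → inj₂ refl
    where
    1≤1+1 : 1ℚ ≤ 1ℚ + 1ℚ
    1≤1+1 = subst (_≤ 1ℚ + 1ℚ) (+-identityʳ 1ℚ) (+-monoʳ-≤ 1ℚ 0≤1)

  module _ (m : ℕ) {y z : Sol n} (z≡⌈y⌉ : ∀ i j → z i j ≡ Grid.roundUp m (y i j)) where

    open Grid m

    Triangle-roundUp : LPFeasible y → Triangle z
    Triangle-roundUp (triangle , y∈cube) i j k i≢j i≢k j≢k =
      subst₂ _≤_ (sym (val-z i j)) (sym (cong₂ _+_ (val-z i k) (val-z j k)))
        (roundUp-subadditive (triangle i j k i≢j i≢k j≢k) (val-y≤1 i k i≢k) (val-y≤1 j k j≢k))
      where
      val-z : ∀ i j → val z i j ≡ roundUp (val y i j)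
      val-z = val-map {roundUp} {y} z≡⌈y⌉
      val-y≤1 : ∀ i j → i ≢ j → val y i j ≤ 1ℚ
      val-y≤1 = val-fromUpper {_≤ 1ℚ} {y} (λ i j i<j → proj₂ (y∈cube i j i<j))

    LPFeasible-roundUp : LPFeasible y → LPFeasible z
    LPFeasible-roundUp y-feasible = Triangle-roundUp y-feasible , λ i j _ →
      subst (0ℚ ≤_) (sym (z≡⌈y⌉ i j)) (roundUp-nonNeg (y i j)) ,
      subst (_≤ 1ℚ) (sym (z≡⌈y⌉ i j)) (roundUp-≤1 (y i j))

    ILPFeasible-roundUp : ILPFeasible y → ILPFeasible z
    ILPFeasible-roundUp y-feasible = Triangle-roundUp (ILPFeasible⇒LPFeasible y-feasible) , λ i j i<j →
      fixed (z≡⌈y⌉ i j) (proj₂ y-feasible i j i<j)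
      where
      fixed : ∀ {q r} → r ≡ roundUp q → (q ≡ 0ℚ) ⊎ (q ≡ 1ℚ) → (r ≡ 0ℚ) ⊎ (r ≡ 1ℚ)
      fixed r≡⌈q⌉ (inj₁ refl) = inj₁ (trans r≡⌈q⌉ roundUp-0)
      fixed r≡⌈q⌉ (inj₂ refl) = inj₂ (trans r≡⌈q⌉ roundUp-1)

module _ {n : ℕ} (G : Graph n) where

  objective-roundUp : ∀ m {δ μ} {y z : Sol n} → 0ℚ < μ → μ ≤ 1ℚ → 0ℚ ≤ δ → Grid.w m ≤ δ * μ →
                      InUnitCube y → (∀ i j → z i j ≡ Grid.roundUp m (y i j)) →
                      objective G μ z ≤ (1ℚ + δ) * objective G μ y
  objective-roundUp m {δ} {μ} {y} {z} 0<μ μ≤1 0≤δ w≤δμ y∈cube z≡⌈y⌉ = begin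
    objective G μ z                           ≤⟨ objective-perturb G (<⇒≤ 0<μ) bounds ⟩
    f + w * edgeCount G                       ≤⟨ +-monoʳ-≤ f (*-monoˡ-≤′ (edgeCount-nonNeg G) w≤δμ) ⟩
    f + (δ * μ) * edgeCount G                 ≡⟨ cong (f +_) (*-assoc δ μ (edgeCount G)) ⟩
    f + δ * (μ * edgeCount G)                 ≤⟨ +-monoʳ-≤ f (*-monoʳ-≤′ 0≤δ
                                                   (objective-lowerBound G (<⇒≤ 0<μ) μ≤1 y∈cube)) ⟩
    f + δ * f                                 ≡⟨ solve 2 (λ f δ → f :+ δ :* f := (con 1ℚ :+ δ) :* f) refl f δ ⟩
    (1ℚ + δ) * f                              ∎
    where
    open ≤-Reasoning
    open Grid m
    f : ℚ
    f = objective G μ y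
    bounds : ∀ i j → toℕ i ℕ.< toℕ j → (y i j ≤ z i j) × (z i j ≤ y i j + w)
    bounds i j i<j = subst (y i j ≤_) (sym (z≡⌈y⌉ i j)) (roundUp-≥ (proj₂ (y∈cube i j i<j))) ,
                     subst (_≤ y i j + w) (sym (z≡⌈y⌉ i j)) (roundUp-≤ (proj₁ (y∈cube i j i<j)))

  module _ {Fe : Sol n → Set} (Fe? : Decidable Fe) (Fe⇒LP : ∀ {x} → Fe x → LPFeasible x) (Fe-ones : Fe ones)
           (Fe-roundUp : ∀ m {y z : Sol n} → (∀ i j → z i j ≡ Grid.roundUp m (y i j)) → Fe y → Fe z) where

    approximateSolution : ∀ {δ μ} → 0ℚ < δ → 0ℚ < μ → μ ≤ 1ℚ → ∃ (Approx Fe G δ μ)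
    approximateSolution {δ} {μ} 0<δ 0<μ μ≤1 =
      let m , w≤δμ = ⅟-below (δ * μ) (*-pos 0<δ 0<μ)
          x , Fe-x , x-minimal = minimiser (objective G μ) Fe? Fe-ones (gridSolutions m)
      in x , Fe-x , λ y Fe-y →
        let z , z∈grid , z≡⌈y⌉ = find (roundUp∈gridSolutions m y)
        in ≤-trans (x-minimal z∈grid (Fe-roundUp m z≡⌈y⌉ Fe-y))
                   (objective-roundUp m 0<μ μ≤1 (<⇒≤ 0<δ) w≤δμ (proj₂ (Fe⇒LP Fe-y)) z≡⌈y⌉)

  module Rescale {u s μ λ' : ℚ} {x y : Sol n} (x∈cube : InUnitCube x) (y∈cube : InUnitCube y)
           (0≤u : 0ℚ ≤ u) (0≤s : 0ℚ ≤ s) (0≤λ : 0ℚ ≤ λ') where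

    private
      f : ℚ → Sol n → ℚ
      f = objective G

    rescale-up : μ ≤ λ' → u * λ' ≤ μ → f μ x ≤ s * f μ y → λ' * (u * f λ' x) ≤ λ' * (s * f λ' y)
    rescale-up μ≤λ uλ≤μ x≤sy = begin
      λ' * (u * f λ' x)     ≡⟨ sym (*-assoc λ' u (f λ' x)) ⟩
      (λ' * u) * f λ' x     ≡⟨ cong (_* f λ' x) (*-comm λ' u) ⟩
      (u * λ') * f λ' x     ≤⟨ *-monoˡ-≤′ (objective-nonNeg G 0≤λ x∈cube) uλ≤μ ⟩
      μ * f λ' x            ≤⟨ objective-scale G x∈cube μ≤λ ⟩
      λ' * f μ x            ≤⟨ *-monoʳ-≤′ 0≤λ x≤sy ⟩
      λ' * (s * f μ y)      ≤⟨ *-monoʳ-≤′ 0≤λ (*-monoʳ-≤′ 0≤s (objective-monoˡ-≤ G y∈cube μ≤λ)) ⟩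
      λ' * (s * f λ' y)     ∎
      where open ≤-Reasoning

    rescale-down : λ' ≤ μ → u * μ ≤ λ' → f μ x ≤ s * f μ y → λ' * (u * f λ' x) ≤ λ' * (s * f λ' y)
    rescale-down λ≤μ uμ≤λ x≤sy = begin
      λ' * (u * f λ' x)          ≤⟨ *-monoʳ-≤′ 0≤λ (*-monoʳ-≤′ 0≤u (objective-monoˡ-≤ G x∈cube λ≤μ)) ⟩
      λ' * (u * f μ x)           ≤⟨ *-monoʳ-≤′ 0≤λ (*-monoʳ-≤′ 0≤u x≤sy) ⟩
      λ' * (u * (s * f μ y))     ≡⟨ solve 4 (λ l u s a → l :* (u :* (s :* a)) := (s :* u) :* (l :* a)) refl λ' u s (f μ y) ⟩
      (s * u) * (λ' * f μ y)     ≤⟨ *-monoʳ-≤′ (*-nonNeg 0≤s 0≤u) (objective-scale G y∈cube λ≤μ) ⟩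
      (s * u) * (μ * f λ' y)     ≡⟨ solve 4 (λ s u m a → (s :* u) :* (m :* a) := s :* ((u :* m) :* a)) refl s u μ (f λ' y) ⟩
      s * ((u * μ) * f λ' y)     ≤⟨ *-monoʳ-≤′ 0≤s (*-monoˡ-≤′ (objective-nonNeg G 0≤λ y∈cube) uμ≤λ) ⟩
      s * (λ' * f λ' y)          ≡⟨ solve 3 (λ s l a → s :* (l :* a) := l :* (s :* a)) refl s λ' (f λ' y) ⟩
      λ' * (s * f λ' y)          ∎
      where open ≤-Reasoning

  Approx-transfer : ∀ {Fe : Sol n → Set} → (∀ {x} → Fe x → LPFeasible x) →
                    ∀ {ε δ u μ λ' x} → 0ℚ ≤ δ → 0ℚ < u → 0ℚ < λ' → 1ℚ + δ ≤ (1ℚ + ε) * u →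
                    u * λ' ≤ μ → u * μ ≤ λ' → Approx Fe G δ μ x → Approx Fe G ε λ' x
  Approx-transfer {Fe} Fe⇒LP {ε} {δ} {u} {μ} {λ'} {x} 0≤δ 0<u 0<λ s≤ru uλ≤μ uμ≤λ (Fe-x , x-approx) =
    Fe-x , λ y Fe-y → *-cancelˡ-≤′ 0<u (begin
      u * objective G λ' x                 ≤⟨ *-cancelˡ-≤′ 0<λ (ratio y Fe-y) ⟩
      (1ℚ + δ) * objective G λ' y          ≤⟨ *-monoˡ-≤′ (objective-nonNeg G (<⇒≤ 0<λ) (cube Fe-y)) s≤ru ⟩
      ((1ℚ + ε) * u) * objective G λ' y    ≡⟨ solve 3 (λ r u a → (r :* u) :* a := u :* (r :* a))
                                                  refl (1ℚ + ε) u (objective G λ' y) ⟩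
      u * ((1ℚ + ε) * objective G λ' y)    ∎)
    where
    open ≤-Reasoning
    cube : ∀ {y} → Fe y → InUnitCube y
    cube Fe-y = proj₂ (Fe⇒LP Fe-y)
    ratio : ∀ y → Fe y → λ' * (u * objective G λ' x) ≤ λ' * ((1ℚ + δ) * objective G λ' y)
    ratio y Fe-y = [ (λ μ≤λ → rescale-up μ≤λ uλ≤μ (x-approx y Fe-y))
                   , (λ λ≤μ → rescale-down λ≤μ uμ≤λ (x-approx y Fe-y)) ]′ (≤-total μ λ')
      where open Rescale (cube Fe-x) (cube Fe-y) (<⇒≤ 0<u) (<⇒≤ (1+-pos 0≤δ)) (<⇒≤ 0<λ)

geometric-cover : ∀ {v λ'} K → v ^ℚ K ≤ λ' → λ' < 1ℚ → ∃ λ j → j ℕ.< K × v ^ℚ suc j ≤ λ' × λ' ≤ v ^ℚ j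
geometric-cover zero    1≤λ λ<1 = ⊥-elim (<-irrefl refl (≤-<-trans 1≤λ λ<1))
geometric-cover {v} {λ'} (suc k) v^K≤λ λ<1 = step (v ^ℚ k ≤? λ')
  where
  step : Dec (v ^ℚ k ≤ λ') → ∃ λ j → j ℕ.< suc k × v ^ℚ suc j ≤ λ' × λ' ≤ v ^ℚ j
  step (yes v^k≤λ) = let j , j<k , below = geometric-cover k v^k≤λ λ<1 in j , ℕₚ.m<n⇒m<1+n j<k , below
  step (no  v^k≰λ) = k , ℕₚ.n<1+n k , v^K≤λ , <⇒≤ (≰⇒> v^k≰λ)

module ParameterGrid {n k : ℕ} {ε : ℚ} (0<ε : 0ℚ < ε) (2≤n : 2 ℕ.≤ n) (floorLog : IsFloorLog (1ℚ + ε) n k) where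

  K : ℕ
  K = suc k

  δ r s : ℚ
  δ = ⅟ (k ℕ.+ K)
  r = 1ℚ + ε
  s = 1ℚ + δ

  0<δ : 0ℚ < δ
  0<δ = ⅟-pos (k ℕ.+ K)

  0<r : 0ℚ < r
  0<r = 1+-pos (<⇒≤ 0<ε)

  instance
    r≢0 : NonZero r
    r≢0 = pos⇒nonZero r {{positive 0<r}}

  u v : ℚ
  u = s * 1/ r
  v = u * u

  μ : ℕ → ℚ
  μ j = u * v ^ℚ j

  0<1/r : 0ℚ < 1/ r
  0<1/r = positive⁻¹ (1/ r) {{1/pos⇒pos r {{positive 0<r}}}}

  0<u : 0ℚ < u
  0<u = *-pos (1+-pos (<⇒≤ 0<δ)) 0<1/r

  u*r≡s : u * r ≡ s
  u*r≡s = trans (*-assoc s (1/ r) r) (trans (cong (s *_) (*-inverseˡ r)) (*-identityʳ s))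

  s≤r*u : s ≤ r * u
  s≤r*u = ≤-reflexive (sym (trans (*-comm r u) u*r≡s))

  s^K≤2 : s ^ℚ K ≤ ℕtoℚ 2
  s^K≤2 = [1+1/2K]^K≤2 k

  2≤nℚ : ℕtoℚ 2 ≤ ℕtoℚ n
  2≤nℚ = ℕtoℚ-mono-≤ 2≤n

  0<n : 0ℚ < ℕtoℚ n
  0<n = <-≤-trans (ℕtoℚ-pos 1) 2≤nℚ

  s≤r : s ≤ r
  s≤r = ≮⇒≥ λ r<s → <-irrefl refl (<-≤-trans (proj₂ floorLog)
          (≤-trans (^-monoˡ-≤ K (<⇒≤ 0<r) (<⇒≤ r<s)) (≤-trans s^K≤2 2≤nℚ)))

  u≤1 : u ≤ 1ℚ
  u≤1 = ≤-trans (*-monoˡ-≤′ (<⇒≤ 0<1/r) s≤r)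
                (≤-reflexive (*-inverseʳ r))

  0<μ : ∀ j → 0ℚ < μ j
  0<μ j = *-pos 0<u (^-pos j (*-pos 0<u 0<u))

  μ≤1 : ∀ j → μ j ≤ 1ℚ
  μ≤1 j = *-≤1 (<⇒≤ 0<u) u≤1 (^-≤1 j (*-nonNeg (<⇒≤ 0<u) (<⇒≤ 0<u)) (*-≤1 (<⇒≤ 0<u) u≤1 u≤1))

  u^K*n≤2 : u ^ℚ K * ℕtoℚ n ≤ ℕtoℚ 2
  u^K*n≤2 = begin
    u ^ℚ K * ℕtoℚ n      ≤⟨ *-monoʳ-≤′ (^-nonNeg K (<⇒≤ 0<u)) (<⇒≤ (proj₂ floorLog)) ⟩
    u ^ℚ K * r ^ℚ K      ≡⟨ sym (^-distribʳ-* u r K) ⟩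
    (u * r) ^ℚ K         ≡⟨ cong (_^ℚ K) u*r≡s ⟩
    s ^ℚ K               ≤⟨ s^K≤2 ⟩
    ℕtoℚ 2               ∎
    where open ≤-Reasoning

  v^K<λ : ∀ {λ'} → ℕtoℚ 4 < λ' * (ℕtoℚ n * ℕtoℚ n) → v ^ℚ K < λ'
  v^K<λ {λ'} 4<λn² = *-cancelʳ-<-nonNeg (ℕtoℚ n * ℕtoℚ n) {{nonNegative (*-nonNeg (<⇒≤ 0<n) (<⇒≤ 0<n))}}
    (≤-<-trans (begin
      v ^ℚ K * (ℕtoℚ n * ℕtoℚ n)            ≡⟨ cong (_* (ℕtoℚ n * ℕtoℚ n)) (^-distribʳ-* u u K) ⟩
      (a * a) * (ℕtoℚ n * ℕtoℚ n)           ≡⟨ solve 2 (λ a n → (a :* a) :* (n :* n) := (a :* n) :* (a :* n))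
                                                   refl a (ℕtoℚ n) ⟩
      (a * ℕtoℚ n) * (a * ℕtoℚ n)           ≤⟨ *-monoˡ-≤′ (*-nonNeg (^-nonNeg K (<⇒≤ 0<u)) (<⇒≤ 0<n)) u^K*n≤2 ⟩
      ℕtoℚ 2 * (a * ℕtoℚ n)                 ≤⟨ *-monoʳ-≤′ (ℕtoℚ-nonNeg 2) u^K*n≤2 ⟩
      ℕtoℚ 2 * ℕtoℚ 2                       ≡⟨⟩
      ℕtoℚ 4                                ∎) 4<λn²)
    where
    open ≤-Reasoning
    a : ℚ
    a = u ^ℚ K

module _ {n : ℕ} (G : Graph n) {Fe : Sol n → Set} (Fe⇒LP : ∀ {x} → Fe x → LPFeasible x)
         (approximate : ∀ {δ μ} → 0ℚ < δ → 0ℚ < μ → μ ≤ 1ℚ → ∃ (Approx Fe G δ μ)) where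

  approximatingFamily : ∀ {ε} k → 0ℚ < ε → 2 ℕ.≤ n → IsFloorLog (1ℚ + ε) n k →
    Σ (List (Sol n)) (λ S →
      (length S ℕ.≤ k ℕ.+ 2)
      × All Fe S
      × (∀ (λ' : ℚ) → ℕtoℚ 4 < λ' * (ℕtoℚ n * ℕtoℚ n) → λ' < 1ℚ → Any (Approx Fe G ε λ') S))
  approximatingFamily {ε} k 0<ε 2≤n floorLog =
    S , length-S , applyUpTo⁺₂ solution K (λ j → proj₁ (solution-approx j)) , covered
    where
    open ParameterGrid {k = k} 0<ε 2≤n floorLog
    solution : ℕ → Sol n
    solution j = proj₁ (approximate 0<δ (0<μ j) (μ≤1 j))
    solution-approx : ∀ j → Approx Fe G δ (μ j) (solution j)
    solution-approx j = proj₂ (approximate 0<δ (0<μ j) (μ≤1 j))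
    S : List (Sol n)
    S = applyUpTo solution K
    length-S : length S ℕ.≤ k ℕ.+ 2
    length-S = subst (ℕ._≤ k ℕ.+ 2) (sym (length-applyUpTo solution K))
                 (subst (K ℕ.≤_) (ℕₚ.+-comm 2 k) (ℕₚ.n≤1+n K))
    covered : ∀ λ' → ℕtoℚ 4 < λ' * (ℕtoℚ n * ℕtoℚ n) → λ' < 1ℚ → Any (Approx Fe G ε λ') S
    covered λ' 4<λn² λ<1 =
      let j , j<K , v^[1+j]≤λ , λ≤v^j = geometric-cover K (<⇒≤ (v^K<λ 4<λn²)) λ<1
      in applyUpTo⁺ solution
           (Approx-transfer G Fe⇒LP {ε = ε} (<⇒≤ 0<δ) 0<u
             (<-≤-trans (^-pos (suc j) (*-pos 0<u 0<u)) v^[1+j]≤λ) s≤r*u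
             (*-monoʳ-≤′ (<⇒≤ 0<u) λ≤v^j) (subst (_≤ λ') (*-assoc u u (v ^ℚ j)) v^[1+j]≤λ)
             (solution-approx j))
           j<K

theorem3 : ∀ (n : ℕ) → 2 ℕ.≤ n → (G : Graph n) → (ε : ℚ) → 0ℚ < ε →
    (∀ (k : ℕ) → IsFloorLog (1ℚ + ε) n k →
      Σ (List (Sol n)) (λ S →
        (length S ℕ.≤ k ℕ.+ 2)
        × All ILPFeasible S
        × (∀ (λ' : ℚ) → ℕtoℚ 4 < λ' * (ℕtoℚ n * ℕtoℚ n) → λ' < 1ℚ →
             Any (Approx ILPFeasible G ε λ') S)))
    × (∀ (k : ℕ) → IsFloorLog (1ℚ + ε) n k →
      Σ (List (Sol n)) (λ S →
        (length S ℕ.≤ k ℕ.+ 2)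
        × All LPFeasible S
        × (∀ (λ' : ℚ) → ℕtoℚ 4 < λ' * (ℕtoℚ n * ℕtoℚ n) → λ' < 1ℚ →
             Any (Approx LPFeasible G ε λ') S)))
theorem3 n 2≤n G ε 0<ε =
    (λ k → approximatingFamily G ILPFeasible⇒LPFeasible approximateILP k 0<ε 2≤n)
  , (λ k → approximatingFamily G id approximateLP k 0<ε 2≤n)
  where
  approximateILP : ∀ {δ μ} → 0ℚ < δ → 0ℚ < μ → μ ≤ 1ℚ → ∃ (Approx ILPFeasible G δ μ)
  approximateILP = approximateSolution G ILPFeasible? ILPFeasible⇒LPFeasible ones-ILPFeasible ILPFeasible-roundUp
  approximateLP : ∀ {δ μ} → 0ℚ < δ → 0ℚ < μ → μ ≤ 1ℚ → ∃ (Approx LPFeasible G δ μ)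
  approximateLP = approximateSolution G LPFeasible? id (ILPFeasible⇒LPFeasible ones-ILPFeasible) LPFeasible-roundUp
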